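{- Let $l \geq 1$ be a fixed integer. Then for every integer $m \geq l$, \[ \nu_2(A_{l,m+1}) - \nu_2(A_{l,m}) = \nu_2(m+l+1) - \nu_2(m-l+1). \]
   Context: For integers $m \geq 1$ and $0 \leq l \leq m$, $A_{l,m} = \frac{l!\, m!}{2^{m-l}} \sum_{k=l}^{m} 2^{k} \binom{2m-2k}{m-k}\binom{m+k}{m}\binom{k}{l}$ (these are nonzero integers). $\nu_2$ denotes the $2$-adic valuation. -}

module Defs where

open import Data.Nat using (ℕ; zero; suc; _+_; _*_; _∸_; _^_)
open import Data.Nat.DivMod using (_/_; _%_)
open import Data.Nat.Base using (_!)
open import Data.Nat.Combinatorics using (_C_)
open import Data.Nat.Properties using (_≟_; m^n>0)
open import Data.Nat.Base using (>-nonZero)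
open import Data.List using (List; map; upTo; drop)
open import Data.Nat.ListAction using (sum)
open import Relation.Nullary using (yes; no)

-- Σ_{k=l}^{m} f k  (empty when m < l)
sumFromTo : ℕ → ℕ → (ℕ → ℕ) → ℕ
sumFromTo l m f = sum (map f (drop l (upTo (suc m))))

innerSum : ℕ → ℕ → ℕ
innerSum l m = sumFromTo l m (λ k → 2 ^ k * (((2 * m) ∸ (2 * k)) C (m ∸ k)) * ((m + k) C m) * (k C l))

-- A_{l,m} = l! m! / 2^{m-l} * innerSum  (an integer by the paper; exact division in ℕ)
A : ℕ → ℕ → ℕ
A l m = ((l !) * (m !) * innerSum l m) / (2 ^ (m ∸ l))
  where instance _ = >-nonZero (m^n>0 2 (m ∸ l))

-- 2-adic valuation of n (with the convention ν₂ 0 = 0; only used on nonzero arguments).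
-- Fuel-based: ν₂ n counts how many times 2 divides n.
ν₂-fuel : ℕ → ℕ → ℕ
ν₂-fuel zero n = zero
ν₂-fuel (suc f) zero = zero
ν₂-fuel (suc f) (suc n) with (suc n) % 2
... | zero = suc (ν₂-fuel f ((suc n) / 2))
... | suc _ = zero

ν₂ : ℕ → ℕ
ν₂ n = ν₂-fuel n n

{-# OPTIONS --safe #-}

-- Write m = l + n and k = l + i.  Clearing the binomial coefficients, l! m! times the k-th term
-- of the sum defining A_{l,m} is 2^m (n+1)(n+2)⋯(n+2l) · C(n,i) (2(n−i)−1)!! (n+2l+1)⋯(n+2l+i), so
-- A_{l,l+n} = 2^l (n+1)⋯(n+2l) B with B = Σᵢ C(n,i) (2(n−i)−1)!! (n+2l+1)⋯(n+2l+i).  B is odd: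
-- its i = 0 term is an odd double factorial, its i = 1 term contains n(n+2l+1), and every later
-- term contains two consecutive integers.  Hence ν₂(A_{l,l+n}) = l + ν₂((n+1)⋯(n+2l)), and
-- passing from n to n+1 trades the factor n+1 for n+2l+1.

module Submission where

open import Defs
open import Data.Nat
open import Data.Nat.Properties
open import Data.Nat.Combinatorics using (_C_; nC1≡n; nCk≡n!/k![n-k]!; k![n∸k]!∣n!)
open import Data.Nat.DivMod using (_%_; _/_; [m+kn]%n≡m%n; m*n%n≡0; m*n/n≡m; m/n*n≡m)
open import Data.Nat.Induction using (<-rec)
open import Data.Nat.ListAction using (sum)
open import Data.Nat.Tactic.RingSolver using (solve-∀)
open import Data.Integer using (+_; _-_; _⊖_)
open import Data.Integer.Properties using ([+m]-[+n]≡m⊖n; +-cancelˡ-⊖)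
open import Data.List using ([]; _∷_; map; drop; upTo; applyUpTo)
open import Data.List.Properties using (map-applyUpTo)
open import Data.Parity.Base using (0ℙ; 1ℙ; _⁻¹) renaming (_+_ to _ℙ+_; _*_ to _ℙ*_)
import Data.Parity.Properties as ℙ
open import Data.Product using (∃; ∃₂; _,_)
open import Function using (_∘_; id)
open import Relation.Binary.PropositionalEquality
open import Relation.Nullary using (contradiction)

parity≡0ℙ⇒even : ∀ n → parity n ≡ 0ℙ → ∃ λ q → n ≡ 2 * q
parity≡0ℙ⇒even zero          _ = 0 , refl
parity≡0ℙ⇒even (suc (suc n)) p with parity≡0ℙ⇒even n p
... | q , refl = suc q , cong suc (sym (+-suc q (q + 0)))

parity≡1ℙ⇒odd : ∀ n → parity n ≡ 1ℙ → ∃ λ b → n ≡ suc (2 * b)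
parity≡1ℙ⇒odd 1             _ = 0 , refl
parity≡1ℙ⇒odd (suc (suc n)) p with parity≡1ℙ⇒odd n p
... | b , refl = suc b , cong (suc ∘ suc) (sym (+-suc b (b + 0)))

parity-suc : ∀ n → parity (suc n) ≡ parity n ⁻¹
parity-suc = ℙ.+-homo-+ 1

parity-+-even : ∀ m n → parity (m + 2 * n) ≡ parity m
parity-+-even m n =
  trans (ℙ.+-homo-+ m (2 * n)) (trans (cong (parity m ℙ+_) (ℙ.*-homo-* 2 n)) (ℙ.+-identityʳ (parity m)))

parity-*-even : ∀ m n → parity n ≡ 0ℙ → parity (m * n) ≡ 0ℙ
parity-*-even m n p = trans (ℙ.*-homo-* m n) (trans (cong (parity m ℙ*_) p) (ℙ.*-zeroʳ (parity m)))

parity-*-opposite : ∀ m n → parity n ≡ parity m ⁻¹ → parity (m * n) ≡ 0ℙ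
parity-*-opposite m n p = trans (ℙ.*-homo-* m n) (trans (cong (parity m ℙ*_) p) (ℙ.p*p⁻¹≡0ℙ (parity m)))

ν₂-fuel-odd : ∀ f b → ν₂-fuel (suc f) (suc (2 * b)) ≡ 0
ν₂-fuel-odd f b with suc (2 * b) % 2 in eq
... | zero  = contradiction (trans (sym eq) (trans (cong (_% 2) (cong suc (*-comm 2 b))) ([m+kn]%n≡m%n 1 b 2))) λ ()
... | suc _ = refl

ν₂-fuel-double : ∀ f x → .{{NonZero x}} → ν₂-fuel (suc f) (2 * x) ≡ suc (ν₂-fuel f x)
ν₂-fuel-double f x@(suc _) with 2 * x % 2 in eq
... | zero  = cong (suc ∘ ν₂-fuel f) (trans (cong (_/ 2) (*-comm 2 x)) (m*n/n≡m x 2))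
... | suc _ = contradiction (trans (sym eq) (trans (cong (_% 2) (*-comm 2 x)) (m*n%n≡0 x 2))) λ ()

2^*odd≢0 : ∀ a b → NonZero (2 ^ a * suc (2 * b))
2^*odd≢0 a b = m*n≢0 (2 ^ a) _ {{m^n≢0 2 a}}

ν₂-fuel-2^*odd : ∀ {f} a b → a < f → ν₂-fuel f (2 ^ a * suc (2 * b)) ≡ a
ν₂-fuel-2^*odd {suc f} zero b _ = trans (cong (ν₂-fuel (suc f)) (*-identityˡ _)) (ν₂-fuel-odd f b)
ν₂-fuel-2^*odd {suc f} (suc a) b (s≤s a<f) = begin
  ν₂-fuel (suc f) (2 * 2 ^ a * suc (2 * b))   ≡⟨ cong (ν₂-fuel (suc f)) (*-assoc 2 (2 ^ a) _) ⟩
  ν₂-fuel (suc f) (2 * (2 ^ a * suc (2 * b))) ≡⟨ ν₂-fuel-double f _ {{2^*odd≢0 a b}} ⟩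
  suc (ν₂-fuel f (2 ^ a * suc (2 * b)))       ≡⟨ cong suc (ν₂-fuel-2^*odd a b a<f) ⟩
  suc a                                       ∎
  where open ≡-Reasoning

n<2^n : ∀ n → n < 2 ^ n
n<2^n zero    = z<s
n<2^n (suc n) = +-mono-≤-< (m^n>0 2 n) (≤-trans (n<2^n n) (m≤m+n (2 ^ n) 0))

ν₂-2^*odd : ∀ a b → ν₂ (2 ^ a * suc (2 * b)) ≡ a
ν₂-2^*odd a b = ν₂-fuel-2^*odd a b (≤-trans (n<2^n a) (m≤m*n (2 ^ a) (suc (2 * b))))

2^*odd-decomposition : ∀ x → .{{NonZero x}} → ∃₂ λ a b → x ≡ 2 ^ a * suc (2 * b)
2^*odd-decomposition = <-rec P decompose
  where
  P : ℕ → Set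
  P x = .{{NonZero x}} → ∃₂ λ a b → x ≡ 2 ^ a * suc (2 * b)
  decompose : ∀ x → (∀ {y} → y < x → P y) → P x
  decompose x rec with parity x in px
  ... | 1ℙ with parity≡1ℙ⇒odd x px
  ...   | b , x≡1+2b = 0 , b , trans x≡1+2b (sym (*-identityˡ _))
  decompose x rec | 0ℙ with parity≡0ℙ⇒even x px
  ... | q@(suc _) , refl with rec (m<m+n q {q + 0} z<s)
  ...   | a , b , q≡2^a*o = suc a , b , trans (cong (2 *_) q≡2^a*o) (sym (*-assoc 2 (2 ^ a) (suc (2 * b))))

ν₂-* : ∀ x y → .{{NonZero x}} → .{{NonZero y}} → ν₂ (x * y) ≡ ν₂ x + ν₂ y
ν₂-* x y with 2^*odd-decomposition x | 2^*odd-decomposition y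
... | a , b , refl | c , d , refl = begin
  ν₂ ((2 ^ a * suc (2 * b)) * (2 ^ c * suc (2 * d)))   ≡⟨ cong ν₂ (regroup (2 ^ a) (2 ^ c) b d) ⟩
  ν₂ ((2 ^ a * 2 ^ c) * suc (2 * (b + d + 2 * b * d))) ≡⟨ cong (λ p → ν₂ (p * _)) (sym (^-distribˡ-+-* 2 a c)) ⟩
  ν₂ (2 ^ (a + c) * suc (2 * (b + d + 2 * b * d)))     ≡⟨ ν₂-2^*odd (a + c) (b + d + 2 * b * d) ⟩
  a + c                                                 ≡⟨ sym (cong₂ _+_ (ν₂-2^*odd a b) (ν₂-2^*odd c d)) ⟩
  ν₂ (2 ^ a * suc (2 * b)) + ν₂ (2 ^ c * suc (2 * d))   ∎
  where
  open ≡-Reasoning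
  regroup : ∀ p q b d → (p * suc (2 * b)) * (q * suc (2 * d)) ≡ (p * q) * suc (2 * (b + d + 2 * b * d))
  regroup = solve-∀

drop-applyUpTo : ∀ {a} {A : Set a} (f : ℕ → A) l N → drop l (applyUpTo f (l + N)) ≡ applyUpTo (f ∘ (_+_ l)) N
drop-applyUpTo f zero    N = refl
drop-applyUpTo f (suc l) N = drop-applyUpTo (f ∘ suc) l N

sumFromTo≡sum-applyUpTo : ∀ l n f → sumFromTo l (l + n) f ≡ sum (applyUpTo (f ∘ (_+_ l)) (suc n))
sumFromTo≡sum-applyUpTo l n f = begin
  sum (map f (drop l (upTo (suc (l + n)))))  ≡⟨ cong (λ N → sum (map f (drop l (upTo N)))) (sym (+-suc l n)) ⟩
  sum (map f (drop l (upTo (l + suc n))))    ≡⟨ cong (sum ∘ map f) (drop-applyUpTo id l (suc n)) ⟩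
  sum (map f (applyUpTo (_+_ l) (suc n)))    ≡⟨ cong sum (map-applyUpTo (_+_ l) f (suc n)) ⟩
  sum (applyUpTo (f ∘ (_+_ l)) (suc n))      ∎
  where open ≡-Reasoning

*-distribˡ-sum : ∀ c xs → c * sum xs ≡ sum (map (c *_) xs)
*-distribˡ-sum c []       = *-zeroʳ c
*-distribˡ-sum c (x ∷ xs) = trans (*-distribˡ-+ c x (sum xs)) (cong (_+_ (c * x)) (*-distribˡ-sum c xs))

*-distribˡ-sum-applyUpTo : ∀ c f N → c * sum (applyUpTo f N) ≡ sum (applyUpTo ((c *_) ∘ f) N)
*-distribˡ-sum-applyUpTo c f N = trans (*-distribˡ-sum c (applyUpTo f N)) (cong sum (map-applyUpTo f (c *_) N))

applyUpTo-cong : ∀ {a} {A : Set a} {f g : ℕ → A} N → (∀ {i} → i < N → f i ≡ g i) → applyUpTo f N ≡ applyUpTo g N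
applyUpTo-cong zero    eq = refl
applyUpTo-cong (suc N) eq = cong₂ _∷_ (eq z<s) (applyUpTo-cong N (eq ∘ s<s))

parity-sum-even : ∀ f N → (∀ i → parity (f i) ≡ 0ℙ) → parity (sum (applyUpTo f N)) ≡ 0ℙ
parity-sum-even f zero    p = refl
parity-sum-even f (suc N) p = trans (ℙ.+-homo-+ (f 0) _) (cong₂ _ℙ+_ (p 0) (parity-sum-even (f ∘ suc) N (p ∘ suc)))

rising : ℕ → ℕ → ℕ
rising a zero    = 1
rising a (suc t) = rising a t * suc (a + t)

rising≢0 : ∀ a t → NonZero (rising a t)
rising≢0 a zero    = _
rising≢0 a (suc t) = m*n≢0 (rising a t) (suc (a + t)) {{rising≢0 a t}}

factorial-rising : ∀ a t → (a + t) ! ≡ a ! * rising a t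
factorial-rising a zero    = trans (cong _! (+-identityʳ a)) (sym (*-identityʳ (a !)))
factorial-rising a (suc t) = begin
  (a + suc t) !                     ≡⟨ cong _! (+-suc a t) ⟩
  suc (a + t) * (a + t) !           ≡⟨ cong (suc (a + t) *_) (factorial-rising a t) ⟩
  suc (a + t) * (a ! * rising a t)  ≡⟨ regroup (suc (a + t)) (a !) (rising a t) ⟩
  a ! * (rising a t * suc (a + t))  ∎
  where
  open ≡-Reasoning
  regroup : ∀ x y z → x * (y * z) ≡ y * (z * x)
  regroup = solve-∀

rising-shift : ∀ a t → rising a t * suc (a + t) ≡ suc a * rising (suc a) t
rising-shift a zero    = trans (*-identityˡ _) (trans (cong suc (+-identityʳ a)) (sym (*-identityʳ (suc a))))
rising-shift a (suc t) = begin
  rising a t * suc (a + t) * suc (a + suc t)     ≡⟨ cong (_* suc (a + suc t)) (rising-shift a t) ⟩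
  suc a * rising (suc a) t * suc (a + suc t)     ≡⟨ *-assoc (suc a) (rising (suc a) t) (suc (a + suc t)) ⟩
  suc a * (rising (suc a) t * suc (a + suc t))   ≡⟨ cong (λ x → suc a * (rising (suc a) t * suc x)) (+-suc a t) ⟩
  suc a * (rising (suc a) t * suc (suc a + t))   ∎
  where open ≡-Reasoning

parity-rising-2+ : ∀ a t → parity (rising a (2 + t)) ≡ 0ℙ
parity-rising-2+ a t = begin
  parity (rising a t * suc (a + t) * suc (a + suc t))
    ≡⟨ cong parity (*-assoc (rising a t) (suc (a + t)) (suc (a + suc t))) ⟩
  parity (rising a t * (suc (a + t) * suc (a + suc t)))
    ≡⟨ parity-*-even (rising a t) _ (parity-*-opposite (suc (a + t)) (suc (a + suc t)) consecutive) ⟩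
  0ℙ ∎
  where
  open ≡-Reasoning
  consecutive : parity (suc (a + suc t)) ≡ parity (suc (a + t)) ⁻¹
  consecutive = trans (cong (parity ∘ suc) (+-suc a t)) (parity-suc (suc (a + t)))

oddFactorial : ℕ → ℕ
oddFactorial zero    = 1
oddFactorial (suc j) = suc (2 * j) * oddFactorial j

factorial-double : ∀ j → (2 * j) ! ≡ 2 ^ j * j ! * oddFactorial j
factorial-double zero    = refl
factorial-double (suc j) = begin
  (2 * suc j) !
    ≡⟨ cong _! (*-suc 2 j) ⟩
  suc (suc (2 * j)) * (suc (2 * j) * (2 * j) !)
    ≡⟨ cong (λ x → suc (suc (2 * j)) * (suc (2 * j) * x)) (factorial-double j) ⟩
  suc (suc (2 * j)) * (suc (2 * j) * (2 ^ j * j ! * oddFactorial j))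
    ≡⟨ regroup j (2 ^ j) (j !) (oddFactorial j) ⟩
  2 ^ suc j * suc j ! * oddFactorial (suc j) ∎
  where
  open ≡-Reasoning
  regroup : ∀ j p f d → suc (suc (2 * j)) * (suc (2 * j) * (p * f * d)) ≡ (2 * p) * (f + j * f) * (suc (2 * j) * d)
  regroup = solve-∀

parity-oddFactorial : ∀ j → parity (oddFactorial j) ≡ 1ℙ
parity-oddFactorial zero    = refl
parity-oddFactorial (suc j) = trans (ℙ.*-homo-* (suc (2 * j)) (oddFactorial j))
  (cong₂ _ℙ*_ (trans (parity-suc (2 * j)) (cong _⁻¹ (parity-+-even 0 j))) (parity-oddFactorial j))

binomial-factorials : ∀ a b → ((a + b) C a) * (a ! * b !) ≡ (a + b) !
binomial-factorials a b = begin
  ((a + b) C a) * (a ! * b !)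
    ≡⟨ cong (λ c → ((a + b) C a) * (a ! * c !)) (sym (m+n∸m≡n a b)) ⟩
  ((a + b) C a) * (a ! * (a + b ∸ a) !)
    ≡⟨ cong (_* (a ! * (a + b ∸ a) !)) (nCk≡n!/k![n-k]! a≤a+b) ⟩
  (a + b) ! / (a ! * (a + b ∸ a) !) * (a ! * (a + b ∸ a) !)
    ≡⟨ m/n*n≡m (k![n∸k]!∣n! a≤a+b) ⟩
  (a + b) ! ∎
  where
  open ≡-Reasoning
  instance _ = a !* (a + b ∸ a) !≢0
  a≤a+b = m≤m+n a b

central-binomial : ∀ j → ((2 * j) C j) * j ! ≡ 2 ^ j * oddFactorial j
central-binomial j = *-cancelʳ-≡ _ _ (j !) {{j !≢0}} (begin
  ((2 * j) C j) * j ! * j !            ≡⟨ *-assoc ((2 * j) C j) (j !) (j !) ⟩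
  ((2 * j) C j) * (j ! * j !)          ≡⟨ cong (λ n → (n C j) * (j ! * j !)) 2j≡j+j ⟩
  ((j + j) C j) * (j ! * j !)          ≡⟨ binomial-factorials j j ⟩
  (j + j) !                            ≡⟨ cong _! (sym 2j≡j+j) ⟩
  (2 * j) !                            ≡⟨ factorial-double j ⟩
  2 ^ j * j ! * oddFactorial j         ≡⟨ *-assoc (2 ^ j) (j !) _ ⟩
  2 ^ j * (j ! * oddFactorial j)       ≡⟨ cong (_*_ (2 ^ j)) (*-comm (j !) _) ⟩
  2 ^ j * (oddFactorial j * j !)       ≡⟨ *-assoc (2 ^ j) _ (j !) ⟨
  2 ^ j * oddFactorial j * j !         ∎)
  where
  open ≡-Reasoning
  2j≡j+j : 2 * j ≡ j + j
  2j≡j+j = cong (_+_ j) (+-identityʳ j)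

innerTerm : ℕ → ℕ → ℕ → ℕ
innerTerm l m k = 2 ^ k * (((2 * m) ∸ (2 * k)) C (m ∸ k)) * ((m + k) C m) * (k C l)

cofactorTerm : ℕ → ℕ → ℕ → ℕ
cofactorTerm l n i = oddFactorial (n ∸ i) * ((n C i) * rising (n + 2 * l) i)

module _ (l i j : ℕ) where
  private
    n = i + j
    m = l + n
    k = l + i

  innerTerm-cleared : l ! * m ! * innerTerm l m k * (i ! * j !) ≡ 2 ^ m * oddFactorial j * (m + k) !
  innerTerm-cleared = begin
    l ! * m ! * innerTerm l m k * (i ! * j !)
      ≡⟨ cong (λ t → l ! * m ! * t * (i ! * j !)) innerTerm≡ ⟩
    l ! * m ! * (2 ^ k * ((2 * j) C j) * ((m + k) C m) * (k C l)) * (i ! * j !)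
      ≡⟨ regroup (l !) (m !) (2 ^ k) ((2 * j) C j) ((m + k) C m) (k C l) (i !) (j !) ⟩
    2 ^ k * (((2 * j) C j) * j !) * (((m + k) C m) * (m ! * ((k C l) * (l ! * i !))))
      ≡⟨ cong₂ (λ c x → 2 ^ k * c * (((m + k) C m) * (m ! * x))) (central-binomial j) (binomial-factorials l i) ⟩
    2 ^ k * (2 ^ j * oddFactorial j) * (((m + k) C m) * (m ! * k !))
      ≡⟨ cong (2 ^ k * (2 ^ j * oddFactorial j) *_) (binomial-factorials m k) ⟩
    2 ^ k * (2 ^ j * oddFactorial j) * (m + k) !
      ≡⟨ cong (_* (m + k) !) (*-assoc (2 ^ k) (2 ^ j) (oddFactorial j)) ⟨
    2 ^ k * 2 ^ j * oddFactorial j * (m + k) !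
      ≡⟨ cong (λ p → p * oddFactorial j * (m + k) !) (^-distribˡ-+-* 2 k j) ⟨
    2 ^ (k + j) * oddFactorial j * (m + k) !
      ≡⟨ cong (λ e → 2 ^ e * oddFactorial j * (m + k) !) (+-assoc l i j) ⟩
    2 ^ m * oddFactorial j * (m + k) ! ∎
    where
    open ≡-Reasoning
    m∸k≡j : m ∸ k ≡ j
    m∸k≡j = trans (cong (_∸ k) (sym (+-assoc l i j))) (m+n∸m≡n k j)
    innerTerm≡ : innerTerm l m k ≡ 2 ^ k * ((2 * j) C j) * ((m + k) C m) * (k C l)
    innerTerm≡ = cong₂ (λ a b → 2 ^ k * (a C b) * ((m + k) C m) * (k C l))
                  (trans (sym (*-distribˡ-∸ 2 m k)) (cong (2 *_) m∸k≡j)) m∸k≡j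
    regroup : ∀ L M P c₁ c₂ c₃ I J →
      L * M * (P * c₁ * c₂ * c₃) * (I * J) ≡ P * (c₁ * J) * (c₂ * (M * (c₃ * (L * I))))
    regroup = solve-∀

  cofactorTerm-cleared : rising n (2 * l) * ((n C i) * rising (n + 2 * l) i) * (i ! * j !) ≡ (m + k) !
  cofactorTerm-cleared = begin
    rising n (2 * l) * ((n C i) * rising (n + 2 * l) i) * (i ! * j !)
      ≡⟨ regroup (rising n (2 * l)) (n C i) (rising (n + 2 * l) i) (i ! * j !) ⟩
    (n C i) * (i ! * j !) * rising n (2 * l) * rising (n + 2 * l) i
      ≡⟨ cong (λ x → x * rising n (2 * l) * rising (n + 2 * l) i) (binomial-factorials i j) ⟩
    n ! * rising n (2 * l) * rising (n + 2 * l) i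
      ≡⟨ cong (_* rising (n + 2 * l) i) (factorial-rising n (2 * l)) ⟨
    (n + 2 * l) ! * rising (n + 2 * l) i
      ≡⟨ factorial-rising (n + 2 * l) i ⟨
    (n + 2 * l + i) !
      ≡⟨ cong _! (sum≡ l i j) ⟩
    (m + k) ! ∎
    where
    open ≡-Reasoning
    regroup : ∀ r c s x → r * (c * s) * x ≡ c * x * r * s
    regroup = solve-∀
    sum≡ : ∀ l i j → i + j + 2 * l + i ≡ l + (i + j) + (l + i)
    sum≡ = solve-∀

  innerTerm-factorisation :
    l ! * m ! * innerTerm l m k ≡ 2 ^ m * rising n (2 * l) * (oddFactorial j * ((n C i) * rising (n + 2 * l) i))
  innerTerm-factorisation = *-cancelʳ-≡ _ _ (i ! * j !) {{i !* j !≢0}} (begin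
    l ! * m ! * innerTerm l m k * (i ! * j !)       ≡⟨ innerTerm-cleared ⟩
    2 ^ m * oddFactorial j * (m + k) !              ≡⟨ cong (2 ^ m * oddFactorial j *_) cofactorTerm-cleared ⟨
    2 ^ m * oddFactorial j * (r * s * (i ! * j !))  ≡⟨ regroup (2 ^ m) (oddFactorial j) r s (i ! * j !) ⟩
    2 ^ m * r * (oddFactorial j * s) * (i ! * j !)  ∎)
    where
    open ≡-Reasoning
    r = rising n (2 * l)
    s = (n C i) * rising (n + 2 * l) i
    regroup : ∀ p d r s x → p * d * (r * s * x) ≡ p * r * (d * s) * x
    regroup = solve-∀

innerTerm≡cofactorTerm : ∀ l {n i} → i ≤ n →
  l ! * (l + n) ! * innerTerm l (l + n) (l + i) ≡ 2 ^ (l + n) * rising n (2 * l) * cofactorTerm l n i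
innerTerm≡cofactorTerm l {n} {i} i≤n = subst P (m+[n∸m]≡n i≤n) (innerTerm-factorisation l i (n ∸ i))
  where
  P : ℕ → Set
  P n′ = l ! * (l + n′) ! * innerTerm l (l + n′) (l + i)
       ≡ 2 ^ (l + n′) * rising n′ (2 * l) * (oddFactorial (n ∸ i) * ((n′ C i) * rising (n′ + 2 * l) i))

parity-cofactorTerm-suc : ∀ l n i → parity (cofactorTerm l n (suc i)) ≡ 0ℙ
parity-cofactorTerm-suc l n i = parity-*-even (oddFactorial (n ∸ suc i)) _ (binomial*rising i)
  where
  a = n + 2 * l
  binomial*rising : ∀ i → parity ((n C suc i) * rising a (suc i)) ≡ 0ℙ
  binomial*rising zero = begin
    parity ((n C 1) * rising a 1)
      ≡⟨ cong₂ (λ x y → parity (x * y)) (nC1≡n n) (trans (*-identityˡ _) (cong suc (+-identityʳ a))) ⟩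
    parity (n * suc a)
      ≡⟨ parity-*-opposite n (suc a) (trans (parity-suc a) (cong _⁻¹ (parity-+-even n l))) ⟩
    0ℙ ∎
    where open ≡-Reasoning
  binomial*rising (suc t) = parity-*-even (n C (2 + t)) _ (parity-rising-2+ a t)

oddCofactor : ℕ → ℕ → ℕ
oddCofactor l n = sum (applyUpTo (cofactorTerm l n) (suc n))

parity-oddCofactor : ∀ l n → parity (oddCofactor l n) ≡ 1ℙ
parity-oddCofactor l n = trans (ℙ.+-homo-+ (cofactorTerm l n 0) _)
  (cong₂ _ℙ+_ (trans (ℙ.*-homo-* (oddFactorial n) 1) (cong (_ℙ* 1ℙ) (parity-oddFactorial n)))
               (parity-sum-even (cofactorTerm l n ∘ suc) n (parity-cofactorTerm-suc l n)))

innerSum-factorisation : ∀ l n →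
  l ! * (l + n) ! * innerSum l (l + n) ≡ 2 ^ (l + n) * rising n (2 * l) * oddCofactor l n
innerSum-factorisation l n = begin
  c * innerSum l (l + n)
    ≡⟨ cong (c *_) (sumFromTo≡sum-applyUpTo l n (innerTerm l (l + n))) ⟩
  c * sum (applyUpTo (innerTerm l (l + n) ∘ _+_ l) (suc n))
    ≡⟨ *-distribˡ-sum-applyUpTo c (innerTerm l (l + n) ∘ _+_ l) (suc n) ⟩
  sum (applyUpTo (λ i → c * innerTerm l (l + n) (l + i)) (suc n))
    ≡⟨ cong sum (applyUpTo-cong (suc n) (innerTerm≡cofactorTerm l ∘ s≤s⁻¹)) ⟩
  sum (applyUpTo (λ i → d * cofactorTerm l n i) (suc n))
    ≡⟨ *-distribˡ-sum-applyUpTo d (cofactorTerm l n) (suc n) ⟨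
  d * oddCofactor l n ∎
  where
  open ≡-Reasoning
  c = l ! * (l + n) !
  d = 2 ^ (l + n) * rising n (2 * l)

A-factorisation : ∀ l n → A l (l + n) ≡ 2 ^ l * rising n (2 * l) * oddCofactor l n
A-factorisation l n = trans (cong (_/ 2 ^ ((l + n) ∸ l)) cleared) (m*n/n≡m _ (2 ^ ((l + n) ∸ l)))
  where
  instance _ = m^n≢0 2 ((l + n) ∸ l)
  cleared : l ! * (l + n) ! * innerSum l (l + n) ≡ 2 ^ l * rising n (2 * l) * oddCofactor l n * 2 ^ ((l + n) ∸ l)
  cleared = begin
    l ! * (l + n) ! * innerSum l (l + n)  ≡⟨ innerSum-factorisation l n ⟩
    2 ^ (l + n) * r * b                   ≡⟨ cong (λ p → p * r * b) (^-distribˡ-+-* 2 l n) ⟩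
    2 ^ l * 2 ^ n * r * b                 ≡⟨ regroup (2 ^ l) (2 ^ n) r b ⟩
    2 ^ l * r * b * 2 ^ n                 ≡⟨ cong (λ e → 2 ^ l * r * b * 2 ^ e) (m+n∸m≡n l n) ⟨
    2 ^ l * r * b * 2 ^ ((l + n) ∸ l)     ∎
    where
    open ≡-Reasoning
    r = rising n (2 * l)
    b = oddCofactor l n
    regroup : ∀ p q r b → p * q * r * b ≡ p * r * b * q
    regroup = solve-∀

ν₂-A : ∀ l n → ν₂ (A l (l + n)) ≡ ν₂ (rising n (2 * l)) + l
ν₂-A l n with parity≡1ℙ⇒odd (oddCofactor l n) (parity-oddCofactor l n)
... | b , cofactor≡1+2b = begin
  ν₂ (A l (l + n))                  ≡⟨ cong ν₂ (A-factorisation l n) ⟩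
  ν₂ (2 ^ l * r * oddCofactor l n)  ≡⟨ cong ν₂ (trans (cong (2 ^ l * r *_) cofactor≡1+2b) (regroup (2 ^ l) r _)) ⟩
  ν₂ (r * (2 ^ l * suc (2 * b)))    ≡⟨ ν₂-* r (2 ^ l * suc (2 * b)) {{rising≢0 n (2 * l)}} {{2^*odd≢0 l b}} ⟩
  ν₂ r + ν₂ (2 ^ l * suc (2 * b))   ≡⟨ cong (_+_ (ν₂ r)) (ν₂-2^*odd l b) ⟩
  ν₂ r + l                          ∎
  where
  open ≡-Reasoning
  r = rising n (2 * l)
  regroup : ∀ p r o → p * r * o ≡ r * (p * o)
  regroup = solve-∀

ν₂-rising-shift : ∀ a t → ν₂ (rising a t) + ν₂ (suc (a + t)) ≡ ν₂ (suc a) + ν₂ (rising (suc a) t)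
ν₂-rising-shift a t = begin
  ν₂ (rising a t) + ν₂ (suc (a + t))     ≡⟨ ν₂-* (rising a t) (suc (a + t)) {{rising≢0 a t}} ⟨
  ν₂ (rising a t * suc (a + t))          ≡⟨ cong ν₂ (rising-shift a t) ⟩
  ν₂ (suc a * rising (suc a) t)          ≡⟨ ν₂-* (suc a) (rising (suc a) t) {{_}} {{rising≢0 (suc a) t}} ⟩
  ν₂ (suc a) + ν₂ (rising (suc a) t)     ∎
  where open ≡-Reasoning

ν₂-A-step : ∀ l n → ν₂ (A l (l + suc n)) + ν₂ (suc n) ≡ ν₂ (A l (l + n)) + ν₂ (suc (n + 2 * l))
ν₂-A-step l n = begin
  ν₂ (A l (l + suc n)) + ν₂ (suc n)                      ≡⟨ cong (_+ ν₂ (suc n)) (ν₂-A l (suc n)) ⟩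
  ν₂ (rising (suc n) (2 * l)) + l + ν₂ (suc n)           ≡⟨ rotate (ν₂ (rising (suc n) (2 * l))) l (ν₂ (suc n)) ⟩
  ν₂ (suc n) + ν₂ (rising (suc n) (2 * l)) + l           ≡⟨ cong (_+ l) (ν₂-rising-shift n (2 * l)) ⟨
  ν₂ (rising n (2 * l)) + ν₂ (suc (n + 2 * l)) + l       ≡⟨ swap (ν₂ (rising n (2 * l))) (ν₂ (suc (n + 2 * l))) l ⟩
  ν₂ (rising n (2 * l)) + l + ν₂ (suc (n + 2 * l))       ≡⟨ cong (_+ ν₂ (suc (n + 2 * l))) (ν₂-A l n) ⟨
  ν₂ (A l (l + n)) + ν₂ (suc (n + 2 * l))                ∎
  where
  open ≡-Reasoning
  rotate : ∀ x y z → x + y + z ≡ z + x + y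
  rotate = solve-∀
  swap : ∀ x y z → x + y + z ≡ x + z + y
  swap = solve-∀

+m-+n≡+p-+q : ∀ m n p q → m + q ≡ n + p → + m - + n ≡ + p - + q
+m-+n≡+p-+q m n p q eq = begin
  + m - + n            ≡⟨ [+m]-[+n]≡m⊖n m n ⟩
  m ⊖ n                ≡⟨ +-cancelˡ-⊖ q m n ⟨
  (q + m) ⊖ (q + n)    ≡⟨ cong₂ _⊖_ (trans (+-comm q m) eq) (+-comm q n) ⟩
  (n + p) ⊖ (n + q)    ≡⟨ +-cancelˡ-⊖ n p q ⟩
  p ⊖ q                ≡⟨ [+m]-[+n]≡m⊖n p q ⟨
  + p - + q            ∎
  where open ≡-Reasoning

theorem3p1 : (l : ℕ) → 1 ≤ l → (m : ℕ) → l ≤ m →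
    (+ ν₂ (A l (m + 1))) - (+ ν₂ (A l m)) ≡ (+ ν₂ (m + l + 1)) - (+ ν₂ (m ∸ l + 1))
theorem3p1 l _ m l≤m with m≤n⇒∃[o]m+o≡n l≤m
... | n , refl = begin
  + ν₂ (A l (l + n + 1)) - + ν₂ (A l (l + n))  ≡⟨ cong (λ x → + ν₂ (A l x) - + ν₂ (A l (l + n))) m+1≡l+[n+1] ⟩
  + ν₂ (A l (l + suc n)) - + ν₂ (A l (l + n))  ≡⟨ +m-+n≡+p-+q _ _ (ν₂ (suc (n + 2 * l))) (ν₂ (suc n)) (ν₂-A-step l n) ⟩
  + ν₂ (suc (n + 2 * l)) - + ν₂ (suc n)        ≡⟨ cong₂ (λ x y → + ν₂ x - + ν₂ y) m+l+1≡n+2l+1 m∸l+1≡n+1 ⟨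
  + ν₂ (l + n + l + 1) - + ν₂ (l + n ∸ l + 1)  ∎
  where
  open ≡-Reasoning
  m+1≡l+[n+1] : l + n + 1 ≡ l + suc n
  m+1≡l+[n+1] = trans (+-assoc l n 1) (cong (_+_ l) (+-comm n 1))
  m+l+1≡n+2l+1 : l + n + l + 1 ≡ suc (n + 2 * l)
  m+l+1≡n+2l+1 = regroup l n
    where
    regroup : ∀ l n → l + n + l + 1 ≡ suc (n + 2 * l)
    regroup = solve-∀
  m∸l+1≡n+1 : l + n ∸ l + 1 ≡ suc n
  m∸l+1≡n+1 = trans (cong (_+ 1) (m+n∸m≡n l n)) (+-comm n 1)
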